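{- Let $s\ge1$, $r\in\mathbb Z$, $\alpha\in\mathbb N$, $\beta\in\mathbb Z$ with $0\le\beta<\alpha$ and $r+\alpha>0$, and for $n\ge0$ let $T^{(\alpha,\beta,r)}_{n+1,s}=\sum_{k}\binom{n-rk}{\beta+\alpha k}_{[s]}$ (sum over all integers $k$). Then, as formal power series, $$\sum_{n\ge0}T^{(\alpha,\beta,r)}_{n+1,s}x^{n}=\frac{(1-x)^{\alpha-\beta-1}(x+x^{2}+\cdots+x^{s})^{\beta}}{(1-x)^{\alpha}-x^{r+\alpha}(1+x+\cdots+x^{s-1})^{\alpha}}.$$
   Context: For integers $n,k$ with $0\le k\le n$, $\binom{n}{k}_{[s]}$ is the number of lattice paths from $(0,0)$ to $(n,k)$ using steps from $\{(1,0),(1,1),(2,1),\ldots,(s,1)\}$; for all other integer pairs it is $0$. -}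

module Defs where

open import Data.Nat as N using (ℕ; zero; suc; _⊓_; _∸_)
open import Data.Integer as Z using (ℤ; +_; -[1+_])
open import Data.List using (List; map; upTo; foldr)

sumℕ : List ℕ → ℕ
sumℕ = foldr N._+_ 0

sumℤ : List ℤ → ℤ
sumℤ = foldr Z._+_ (+ 0)

-- Lattice path numbers.
-- paths s n k = number of lattice paths from (0,0) to (n,k) with steps
-- (1,0), (1,1), (2,1), ..., (s,1).  Defined by classifying paths by
-- their last step: either (1,0) (coming from (n-1,k)) or (j+1,1) for
-- 0 ≤ j < s with j+1 ≤ n (coming from (n-1-j, k-1)).

paths : ℕ → ℕ → ℕ → ℕ
paths s zero    zero    = 1
paths s zero    (suc k) = 0
paths s (suc n) zero    = paths s n zero
paths s (suc n) (suc k) =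
  paths s n (suc k) N.+ sumℕ (map (λ j → paths s (n ∸ j) k) (upTo (s ⊓ suc n)))

-- binom s n k  =  (n choose k)_[s]  for integer n, k; zero unless 0 ≤ k ≤ n
-- (paths already vanishes when k > n).
binom : ℕ → ℤ → ℤ → ℕ
binom s (+ n) (+ k) = paths s n k
binom s (+ n) -[1+ k ] = 0
binom s -[1+ n ] k = 0

-- The sum over all integers k is taken over the range -n ≤ k ≤ n, which
-- contains every k with a nonzero term when α ≥ 1, 0 ≤ β, r + α > 0
-- (nonzero terms need 0 ≤ β + α k ≤ n - r k, forcing 0 ≤ k ≤ n).

rangeℤ : ℕ → List ℤ
rangeℤ n = map (λ i → + i Z.- + n) (upTo (suc (n N.+ n)))

T : (α : ℕ) (β r : ℤ) (s : ℕ) → ℕ → ℤ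
T α β r s n =
  sumℤ (map (λ k → + binom s (+ n Z.- r Z.* k) (β Z.+ + α Z.* k)) (rangeℤ n))

PS : Set
PS = ℕ → ℤ

infixl 6 _⊕_ _⊝_
infixl 7 _⊛_
infixr 8 _^ₚ_

_⊕_ : PS → PS → PS
(f ⊕ g) n = f n Z.+ g n

_⊝_ : PS → PS → PS
(f ⊝ g) n = f n Z.- g n

_⊛_ : PS → PS → PS
(f ⊛ g) n = sumℤ (map (λ i → f i Z.* g (n ∸ i)) (upTo (suc n)))

oneₚ : PS
oneₚ zero    = + 1
oneₚ (suc _) = + 0

Xₚ : PS
Xₚ 1 = + 1
Xₚ _ = + 0

_^ₚ_ : PS → ℕ → PS
f ^ₚ zero  = oneₚ
f ^ₚ suc m = f ⊛ (f ^ₚ m)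

-- x^a + x^(a+1) + ... + x^(b-1)   (empty if b ≤ a)
geomₚ : ℕ → ℕ → PS
geomₚ a b = go (b ∸ a)
  where
  go : ℕ → PS
  go zero    = λ _ → + 0
  go (suc m) = go m ⊕ Xₚ ^ₚ (a N.+ m)

numer : (α β s : ℕ) → PS
numer α β s = (oneₚ ⊝ Xₚ) ^ₚ (α ∸ β ∸ 1) ⊛ geomₚ 1 (suc s) ^ₚ β

-- Denominator (1-x)^α - x^(r+α) (1 + x + ... + x^(s-1))^α, with r+α = e
denom : (α e s : ℕ) → PS
denom α e s = (oneₚ ⊝ Xₚ) ^ₚ α ⊝ Xₚ ^ₚ e ⊛ geomₚ 0 s ^ₚ α

-- Let P_k = Σₙ paths(n,k) xⁿ. Classifying paths by their last step gives (1-x) P₀ = 1 and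
-- (1-x) P_{k+1} = (x + ⋯ + xˢ) P_k, hence (1-x)^{k+1} P_k = (x + ⋯ + xˢ)^k.  Put e = r + α and
-- term_k = Σₙ binom(n - rk, β + αk) xⁿ.  Then x^{αk} term_k = x^{ek} P_{β+αk}, so
-- (1-x)^α term_{k+1} = x^e (1 + ⋯ + x^{s-1})^α term_k, and multiplying Σ_{k≤K} term_k by the
-- denominator telescopes to (1-x)^α term₀ - x^e (1 + ⋯ + x^{s-1})^α term_K, where (1-x)^α term₀ is
-- the numerator.  As term_k has order at least k (and e ≥ 1), the coefficient of xⁿ only sees
-- the partial sum with K = n, which agrees with T up to xⁿ.

module Submission where

open import Defs
open import Data.Nat using (ℕ; _≥_)
open import Data.Integer using (ℤ; +_; _+_; _<_; _≤_; ∣_∣)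
open import Relation.Binary.PropositionalEquality using (_≡_)

open import Algebra.Bundles using (CommutativeMonoid)
open import Data.Integer using (-[1+_]; -_; _-_; _*_; _⊖_; +<+)
import Data.Integer.Properties as ℤ
open import Data.Integer.Tactic.RingSolver using (solve-∀)
open import Data.List using ([]; _∷_; map; upTo; applyUpTo)
open import Data.List.Properties using (map-applyUpTo; map-∘)
open import Data.Nat as ℕ using (zero; suc; _⊓_; _∸_; z≤n; s≤s)
import Data.Nat.Properties as ℕ
open import Data.Product using (_,_)
open import Function using (_∘_; id)
open import Relation.Binary.Bundles using (Setoid)
open import Relation.Binary.PropositionalEquality using (refl; sym; trans; cong; cong₂; subst; module ≡-Reasoning)
import Relation.Binary.Reasoning.Setoid as SetoidReasoning
import Algebra.Properties.CommutativeSemigroup as CSP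
import Algebra.Solver.CommutativeMonoid as CommutativeMonoidSolver

∑ : ℕ → (ℕ → ℤ) → ℤ
∑ zero    f = + 0
∑ (suc n) f = f 0 + ∑ n (f ∘ suc)

sumℤ-applyUpTo : ∀ (f : ℕ → ℤ) n → sumℤ (applyUpTo f n) ≡ ∑ n f
sumℤ-applyUpTo f zero    = refl
sumℤ-applyUpTo f (suc n) = cong (_+_ (f 0)) (sumℤ-applyUpTo (f ∘ suc) n)

sumℤ-map-upTo : ∀ (f : ℕ → ℤ) n → sumℤ (map f (upTo n)) ≡ ∑ n f
sumℤ-map-upTo f n = trans (cong sumℤ (map-applyUpTo id f n)) (sumℤ-applyUpTo f n)

sumℕ-applyUpTo : ∀ (f : ℕ → ℕ) n → + sumℕ (applyUpTo f n) ≡ ∑ n (+_ ∘ f)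
sumℕ-applyUpTo f zero    = refl
sumℕ-applyUpTo f (suc n) = trans (ℤ.pos-+ (f 0) _) (cong (_+_ (+ f 0)) (sumℕ-applyUpTo (f ∘ suc) n))

sumℕ-map-upTo : ∀ (f : ℕ → ℕ) n → + sumℕ (map f (upTo n)) ≡ ∑ n (+_ ∘ f)
sumℕ-map-upTo f n = trans (cong (+_ ∘ sumℕ) (map-applyUpTo id f n)) (sumℕ-applyUpTo f n)

∑-cong : ∀ n {f g : ℕ → ℤ} → (∀ i → i ℕ.< n → f i ≡ g i) → ∑ n f ≡ ∑ n g
∑-cong zero    f≡g = refl
∑-cong (suc n) f≡g = cong₂ _+_ (f≡g 0 (s≤s z≤n)) (∑-cong n (λ i i<n → f≡g (suc i) (s≤s i<n)))

∑-zero : ∀ n {f : ℕ → ℤ} → (∀ i → i ℕ.< n → f i ≡ + 0) → ∑ n f ≡ + 0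
∑-zero zero    f≡0 = refl
∑-zero (suc n) f≡0 = cong₂ _+_ (f≡0 0 (s≤s z≤n)) (∑-zero n (λ i i<n → f≡0 (suc i) (s≤s i<n)))

∑-+ : ∀ m n (f : ℕ → ℤ) → ∑ (m ℕ.+ n) f ≡ ∑ m f + ∑ n (λ i → f (m ℕ.+ i))
∑-+ zero    n f = sym (ℤ.+-identityˡ _)
∑-+ (suc m) n f = trans (cong (_+_ (f 0)) (∑-+ m n (f ∘ suc))) (sym (ℤ.+-assoc (f 0) _ _))

∑-snoc : ∀ n (f : ℕ → ℤ) → ∑ (suc n) f ≡ ∑ n f + f n
∑-snoc zero    f = trans (ℤ.+-identityʳ (f 0)) (sym (ℤ.+-identityˡ (f 0)))
∑-snoc (suc n) f = trans (cong (_+_ (f 0)) (∑-snoc n (f ∘ suc))) (sym (ℤ.+-assoc (f 0) _ _))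

infix 4 _≈ₚ_
record _≈ₚ_ (f g : PS) : Set where
  constructor mk≈ₚ
  field at : ∀ n → f n ≡ g n
open _≈ₚ_ public

≈ₚ-setoid : Setoid _ _
≈ₚ-setoid = record
  { Carrier       = PS
  ; _≈_           = _≈ₚ_
  ; isEquivalence = record
    { refl  = mk≈ₚ λ n → refl
    ; sym   = λ f≈g → mk≈ₚ λ n → sym (at f≈g n)
    ; trans = λ f≈g g≈h → mk≈ₚ λ n → trans (at f≈g n) (at g≈h n)
    }
  }

open Setoid ≈ₚ-setoid public using () renaming (refl to ≈ₚ-refl; sym to ≈ₚ-sym; trans to ≈ₚ-trans)
module ≈ₚ-Reasoning = SetoidReasoning ≈ₚ-setoid

≡⇒≈ₚ : ∀ {f g} → f ≡ g → f ≈ₚ g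
≡⇒≈ₚ refl = ≈ₚ-refl

⊕-cong : ∀ {f f′ g g′} → f ≈ₚ f′ → g ≈ₚ g′ → f ⊕ g ≈ₚ f′ ⊕ g′
⊕-cong f≈ g≈ = mk≈ₚ λ n → cong₂ _+_ (at f≈ n) (at g≈ n)

⊝-cong : ∀ {f f′ g g′} → f ≈ₚ f′ → g ≈ₚ g′ → f ⊝ g ≈ₚ f′ ⊝ g′
⊝-cong f≈ g≈ = mk≈ₚ λ n → cong₂ _-_ (at f≈ n) (at g≈ n)

conv : PS → PS → PS
conv f g zero    = f 0 * g 0
conv f g (suc n) = f 0 * g (suc n) + conv (f ∘ suc) g n

⊛≡conv : ∀ f g n → (f ⊛ g) n ≡ conv f g n
⊛≡conv f g n = trans (sumℤ-map-upTo (λ i → f i * g (n ∸ i)) (suc n)) (∑≡conv f n)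
  where
  ∑≡conv : ∀ f n → ∑ (suc n) (λ i → f i * g (n ∸ i)) ≡ conv f g n
  ∑≡conv f zero    = ℤ.+-identityʳ _
  ∑≡conv f (suc n) = cong (_+_ (f 0 * g (suc n))) (∑≡conv (f ∘ suc) n)

conv-congˡ : ∀ {f f′} g → f ≈ₚ f′ → ∀ n → conv f g n ≡ conv f′ g n
conv-congˡ g f≈ zero    = cong (_* g 0) (at f≈ 0)
conv-congˡ g f≈ (suc n) =
  cong₂ _+_ (cong (_* g (suc n)) (at f≈ 0)) (conv-congˡ g (mk≈ₚ (at f≈ ∘ suc)) n)

conv-congʳ : ∀ f {g g′} n → (∀ i → i ℕ.≤ n → g i ≡ g′ i) → conv f g n ≡ conv f g′ n
conv-congʳ f zero    g≡ = cong (f 0 *_) (g≡ 0 z≤n)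
conv-congʳ f (suc n) g≡ =
  cong₂ _+_ (cong (f 0 *_) (g≡ (suc n) ℕ.≤-refl)) (conv-congʳ (f ∘ suc) n (λ i i≤n → g≡ i (ℕ.m≤n⇒m≤1+n i≤n)))

conv-vanishʳ : ∀ f {g} n → (∀ i → i ℕ.≤ n → g i ≡ + 0) → conv f g n ≡ + 0
conv-vanishʳ f zero    g≡0 = trans (cong (f 0 *_) (g≡0 0 z≤n)) (ℤ.*-zeroʳ (f 0))
conv-vanishʳ f (suc n) g≡0 =
  cong₂ _+_ (trans (cong (f 0 *_) (g≡0 (suc n) ℕ.≤-refl)) (ℤ.*-zeroʳ (f 0)))
            (conv-vanishʳ (f ∘ suc) n (λ i i≤n → g≡0 i (ℕ.m≤n⇒m≤1+n i≤n)))

conv-comm : ∀ f g n → conv f g n ≡ conv g f n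
conv-comm f g zero          = ℤ.*-comm (f 0) (g 0)
conv-comm f g (suc zero)    =
  trans (cong₂ _+_ (ℤ.*-comm (f 0) (g 1)) (ℤ.*-comm (f 1) (g 0))) (ℤ.+-comm (g 1 * f 0) (g 0 * f 1))
conv-comm f g (suc (suc n)) = begin
  a + conv (f ∘ suc) g (suc n)            ≡⟨ cong (_+_ a) (conv-comm (f ∘ suc) g (suc n)) ⟩
  a + (b + conv (g ∘ suc) (f ∘ suc) n)    ≡⟨ cong (λ c → a + (b + c)) (conv-comm (g ∘ suc) (f ∘ suc) n) ⟩
  a + (b + conv (f ∘ suc) (g ∘ suc) n)    ≡⟨ CSP.x∙yz≈y∙xz ℤ.+-commutativeSemigroup a b _ ⟩
  b + (a + conv (f ∘ suc) (g ∘ suc) n)    ≡⟨ cong (_+_ b) (conv-comm f (g ∘ suc) (suc n)) ⟩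
  b + conv (g ∘ suc) f (suc n)            ∎
  where
  open ≡-Reasoning
  a b : ℤ
  a = f 0 * g (suc (suc n))
  b = g 0 * f (suc (suc n))

private
  distrib-step : ∀ a b c x y → (a + b) * c + (x + y) ≡ (a * c + x) + (b * c + y)
  distrib-step = solve-∀
  *-distribʳ-- : ∀ a b c → (a - b) * c ≡ a * c - b * c
  *-distribʳ-- = solve-∀
  distrib-step⁻ : ∀ a b c x y → (a - b) * c + (x - y) ≡ (a * c + x) - (b * c + y)
  distrib-step⁻ = solve-∀
  assoc-step : ∀ a b c x → (a * b) * c + a * x ≡ a * (b * c + x)
  assoc-step = solve-∀
  assoc-step′ : ∀ a b c x y → (a * b) * c + (a * x + y) ≡ a * (b * c + x) + y
  assoc-step′ = solve-∀
  [x+y]-x≡y : ∀ x y → (x + y) - x ≡ y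
  [x+y]-x≡y = solve-∀

conv-⊕ˡ : ∀ f f′ g n → conv (f ⊕ f′) g n ≡ conv f g n + conv f′ g n
conv-⊕ˡ f f′ g zero    = ℤ.*-distribʳ-+ (g 0) (f 0) (f′ 0)
conv-⊕ˡ f f′ g (suc n) =
  trans (cong (_+_ ((f 0 + f′ 0) * g (suc n))) (conv-⊕ˡ (f ∘ suc) (f′ ∘ suc) g n))
        (distrib-step (f 0) (f′ 0) (g (suc n)) _ _)

conv-⊝ˡ : ∀ f f′ g n → conv (f ⊝ f′) g n ≡ conv f g n - conv f′ g n
conv-⊝ˡ f f′ g zero    = *-distribʳ-- (f 0) (f′ 0) (g 0)
conv-⊝ˡ f f′ g (suc n) =
  trans (cong (_+_ ((f 0 - f′ 0) * g (suc n))) (conv-⊝ˡ (f ∘ suc) (f′ ∘ suc) g n))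
        (distrib-step⁻ (f 0) (f′ 0) (g (suc n)) _ _)

conv-scaleˡ : ∀ c f g n → conv (λ i → c * f i) g n ≡ c * conv f g n
conv-scaleˡ c f g zero    = ℤ.*-assoc c (f 0) (g 0)
conv-scaleˡ c f g (suc n) =
  trans (cong (_+_ ((c * f 0) * g (suc n))) (conv-scaleˡ c (f ∘ suc) g n))
        (assoc-step c (f 0) (g (suc n)) _)

conv-assoc : ∀ f g h n → conv (conv f g) h n ≡ conv f (conv g h) n
conv-assoc f g h zero    = ℤ.*-assoc (f 0) (g 0) (h 0)
conv-assoc f g h (suc n) = trans
  (cong (_+_ ((f 0 * g 0) * h (suc n)))
        (trans (conv-⊕ˡ (λ i → f 0 * g (suc i)) (conv (f ∘ suc) g) h n)
               (cong₂ _+_ (conv-scaleˡ (f 0) (g ∘ suc) h n) (conv-assoc (f ∘ suc) g h n))))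
  (assoc-step′ (f 0) (g 0) (h (suc n)) _ _)

conv-identityˡ : ∀ g n → conv oneₚ g n ≡ g n
conv-identityˡ g zero    = ℤ.*-identityˡ (g 0)
conv-identityˡ g (suc n) = begin
  + 1 * g (suc n) + conv (oneₚ ∘ suc) g n
    ≡⟨ cong₂ _+_ (ℤ.*-identityˡ (g (suc n))) (conv-comm (oneₚ ∘ suc) g n) ⟩
  g (suc n) + conv g (oneₚ ∘ suc) n
    ≡⟨ cong (_+_ (g (suc n))) (conv-vanishʳ g n (λ _ _ → refl)) ⟩
  g (suc n) + + 0
    ≡⟨ ℤ.+-identityʳ (g (suc n)) ⟩
  g (suc n) ∎
  where open ≡-Reasoning

⊛-cong : ∀ {f f′ g g′} → f ≈ₚ f′ → g ≈ₚ g′ → f ⊛ g ≈ₚ f′ ⊛ g′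
⊛-cong {f} {f′} {g} {g′} f≈ g≈ = mk≈ₚ λ n → begin
  (f ⊛ g) n     ≡⟨ ⊛≡conv f g n ⟩
  conv f g n    ≡⟨ conv-congˡ g f≈ n ⟩
  conv f′ g n   ≡⟨ conv-congʳ f′ n (λ i _ → at g≈ i) ⟩
  conv f′ g′ n  ≡⟨ ⊛≡conv f′ g′ n ⟨
  (f′ ⊛ g′) n   ∎
  where open ≡-Reasoning

⊛-comm : ∀ f g → f ⊛ g ≈ₚ g ⊛ f
⊛-comm f g = mk≈ₚ λ n → trans (⊛≡conv f g n) (trans (conv-comm f g n) (sym (⊛≡conv g f n)))

⊛-assoc : ∀ f g h → (f ⊛ g) ⊛ h ≈ₚ f ⊛ (g ⊛ h)
⊛-assoc f g h = mk≈ₚ λ n → begin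
  ((f ⊛ g) ⊛ h) n       ≡⟨ ⊛≡conv (f ⊛ g) h n ⟩
  conv (f ⊛ g) h n      ≡⟨ conv-congˡ h (mk≈ₚ (⊛≡conv f g)) n ⟩
  conv (conv f g) h n   ≡⟨ conv-assoc f g h n ⟩
  conv f (conv g h) n   ≡⟨ conv-congʳ f n (λ i _ → ⊛≡conv g h i) ⟨
  conv f (g ⊛ h) n      ≡⟨ ⊛≡conv f (g ⊛ h) n ⟨
  (f ⊛ (g ⊛ h)) n       ∎
  where open ≡-Reasoning

⊛-identityˡ : ∀ f → oneₚ ⊛ f ≈ₚ f
⊛-identityˡ f = mk≈ₚ λ n → trans (⊛≡conv oneₚ f n) (conv-identityˡ f n)

⊛-identityʳ : ∀ f → f ⊛ oneₚ ≈ₚ f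
⊛-identityʳ f = ≈ₚ-trans (⊛-comm f oneₚ) (⊛-identityˡ f)

⊛-distribʳ-⊕ : ∀ f g h → (f ⊕ g) ⊛ h ≈ₚ f ⊛ h ⊕ g ⊛ h
⊛-distribʳ-⊕ f g h = mk≈ₚ λ n →
  trans (⊛≡conv (f ⊕ g) h n) (trans (conv-⊕ˡ f g h n) (sym (cong₂ _+_ (⊛≡conv f h n) (⊛≡conv g h n))))

⊛-distribʳ-⊝ : ∀ f g h → (f ⊝ g) ⊛ h ≈ₚ f ⊛ h ⊝ g ⊛ h
⊛-distribʳ-⊝ f g h = mk≈ₚ λ n →
  trans (⊛≡conv (f ⊝ g) h n) (trans (conv-⊝ˡ f g h n) (sym (cong₂ _-_ (⊛≡conv f h n) (⊛≡conv g h n))))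

⊛-distribˡ-⊕ : ∀ h f g → h ⊛ (f ⊕ g) ≈ₚ h ⊛ f ⊕ h ⊛ g
⊛-distribˡ-⊕ h f g =
  ≈ₚ-trans (⊛-comm h (f ⊕ g)) (≈ₚ-trans (⊛-distribʳ-⊕ f g h) (⊕-cong (⊛-comm f h) (⊛-comm g h)))

⊛-commutativeMonoid : CommutativeMonoid _ _
⊛-commutativeMonoid = record
  { Carrier = PS
  ; _≈_     = _≈ₚ_
  ; _∙_     = _⊛_
  ; ε       = oneₚ
  ; isCommutativeMonoid = record
    { isMonoid = record
      { isSemigroup = record
        { isMagma = record { isEquivalence = Setoid.isEquivalence ≈ₚ-setoid ; ∙-cong = ⊛-cong }
        ; assoc   = ⊛-assoc
        }
      ; identity = ⊛-identityˡ , ⊛-identityʳ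
      }
    ; comm = ⊛-comm
    }
  }

open CSP (CommutativeMonoid.commutativeSemigroup ⊛-commutativeMonoid) public
  using (x∙yz≈y∙xz; xy∙z≈y∙xz; interchange)

⊛-coeff-congʳ : ∀ f {g g′} n → (∀ i → i ℕ.≤ n → g i ≡ g′ i) → (f ⊛ g) n ≡ (f ⊛ g′) n
⊛-coeff-congʳ f {g} {g′} n g≡ = trans (⊛≡conv f g n) (trans (conv-congʳ f n g≡) (sym (⊛≡conv f g′ n)))

⊛-congˡ : ∀ {f f′} g → f ≈ₚ f′ → f ⊛ g ≈ₚ f′ ⊛ g
⊛-congˡ g f≈ = ⊛-cong f≈ (≈ₚ-refl {g})

⊛-congʳ : ∀ f {g g′} → g ≈ₚ g′ → f ⊛ g ≈ₚ f ⊛ g′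
⊛-congʳ f g≈ = ⊛-cong (≈ₚ-refl {f}) g≈

^ₚ-cong : ∀ {f g} → f ≈ₚ g → ∀ m → f ^ₚ m ≈ₚ g ^ₚ m
^ₚ-cong f≈g zero    = ≈ₚ-refl
^ₚ-cong f≈g (suc m) = ⊛-cong f≈g (^ₚ-cong f≈g m)

^ₚ-distribˡ-+-⊛ : ∀ f a b → f ^ₚ (a ℕ.+ b) ≈ₚ f ^ₚ a ⊛ f ^ₚ b
^ₚ-distribˡ-+-⊛ f zero    b = ≈ₚ-sym (⊛-identityˡ (f ^ₚ b))
^ₚ-distribˡ-+-⊛ f (suc a) b =
  ≈ₚ-trans (⊛-congʳ f (^ₚ-distribˡ-+-⊛ f a b)) (≈ₚ-sym (⊛-assoc f (f ^ₚ a) (f ^ₚ b)))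

^ₚ-distrib-⊛ : ∀ f g m → (f ⊛ g) ^ₚ m ≈ₚ f ^ₚ m ⊛ g ^ₚ m
^ₚ-distrib-⊛ f g zero    = ≈ₚ-sym (⊛-identityˡ oneₚ)
^ₚ-distrib-⊛ f g (suc m) =
  ≈ₚ-trans (⊛-congʳ (f ⊛ g) (^ₚ-distrib-⊛ f g m)) (interchange f g (f ^ₚ m) (g ^ₚ m))

^ₚ-*-suc : ∀ f c k → f ^ₚ (c ℕ.* suc k) ≈ₚ f ^ₚ c ⊛ f ^ₚ (c ℕ.* k)
^ₚ-*-suc f c k = ≈ₚ-trans (≡⇒≈ₚ (cong (f ^ₚ_) (ℕ.*-suc c k))) (^ₚ-distribˡ-+-⊛ f c (c ℕ.* k))

data Split (c : ℕ) : ℕ → Set where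
  below : ∀ {n} → n ℕ.< c → Split c n
  above : ∀ t → Split c (c ℕ.+ t)

split : ∀ c n → Split c n
split zero    n       = above n
split (suc c) zero    = below (s≤s z≤n)
split (suc c) (suc n) with split c n
... | below n<c = below (s≤s n<c)
... | above t   = above t

VanishesBelow : ℕ → PS → Set
VanishesBelow n f = ∀ i → i ℕ.< n → f i ≡ + 0

vanishesBelow-mono : ∀ {m n f} → m ℕ.≤ n → VanishesBelow n f → VanishesBelow m f
vanishesBelow-mono m≤n f≡0 i i<m = f≡0 i (ℕ.<-≤-trans i<m m≤n)

⊛-vanishesBelowʳ : ∀ f {g} n → VanishesBelow n g → VanishesBelow n (f ⊛ g)
⊛-vanishesBelowʳ f {g} n g≡0 i i<n =
  trans (⊛≡conv f g i) (conv-vanishʳ f i (λ j j≤i → g≡0 j (ℕ.≤-<-trans j≤i i<n)))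

Xₚ⊛-zero : ∀ f → (Xₚ ⊛ f) 0 ≡ + 0
Xₚ⊛-zero f = trans (⊛≡conv Xₚ f 0) (ℤ.*-zeroˡ (f 0))

Xₚ⊛-suc : ∀ f n → (Xₚ ⊛ f) (suc n) ≡ f n
Xₚ⊛-suc f n = begin
  (Xₚ ⊛ f) (suc n)                         ≡⟨ ⊛≡conv Xₚ f (suc n) ⟩
  + 0 * f (suc n) + conv (Xₚ ∘ suc) f n    ≡⟨ cong₂ _+_ (ℤ.*-zeroˡ (f (suc n))) (conv-congˡ f Xₚ∘suc≈oneₚ n) ⟩
  + 0 + conv oneₚ f n                      ≡⟨ ℤ.+-identityˡ _ ⟩
  conv oneₚ f n                            ≡⟨ conv-identityˡ f n ⟩
  f n                                      ∎
  where
  open ≡-Reasoning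
  Xₚ∘suc≈oneₚ : Xₚ ∘ suc ≈ₚ oneₚ
  Xₚ∘suc≈oneₚ = mk≈ₚ λ { zero → refl ; (suc n) → refl }

Xₚ^⊛-shift : ∀ c f n → (Xₚ ^ₚ c ⊛ f) (c ℕ.+ n) ≡ f n
Xₚ^⊛-shift zero    f n = at (⊛-identityˡ f) n
Xₚ^⊛-shift (suc c) f n =
  trans (at (⊛-assoc Xₚ (Xₚ ^ₚ c) f) (suc c ℕ.+ n)) (trans (Xₚ⊛-suc (Xₚ ^ₚ c ⊛ f) (c ℕ.+ n)) (Xₚ^⊛-shift c f n))

Xₚ^⊛-vanishesBelow : ∀ c f → VanishesBelow c (Xₚ ^ₚ c ⊛ f)
Xₚ^⊛-vanishesBelow (suc c) f zero    _         = trans (at (⊛-assoc Xₚ (Xₚ ^ₚ c) f) 0) (Xₚ⊛-zero (Xₚ ^ₚ c ⊛ f))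
Xₚ^⊛-vanishesBelow (suc c) f (suc n) (s≤s n<c) =
  trans (at (⊛-assoc Xₚ (Xₚ ^ₚ c) f) (suc n)) (trans (Xₚ⊛-suc (Xₚ ^ₚ c ⊛ f) n) (Xₚ^⊛-vanishesBelow c f n n<c))

Xₚ^⊛-preserves-vanishesBelow : ∀ c {f} n → VanishesBelow n f → VanishesBelow (c ℕ.+ n) (Xₚ ^ₚ c ⊛ f)
Xₚ^⊛-preserves-vanishesBelow c {f} n f≡0 i i<c+n with split c i
... | below i<c = Xₚ^⊛-vanishesBelow c f i i<c
... | above t   = trans (Xₚ^⊛-shift c f t) (f≡0 t (ℕ.+-cancelˡ-< c t n i<c+n))

Xₚ^⊛-cancel : ∀ c {f g} → Xₚ ^ₚ c ⊛ f ≈ₚ Xₚ ^ₚ c ⊛ g → f ≈ₚ g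
Xₚ^⊛-cancel c {f} {g} eq = mk≈ₚ λ n → trans (sym (Xₚ^⊛-shift c f n)) (trans (at eq (c ℕ.+ n)) (Xₚ^⊛-shift c g n))

Xₚ^⊛-unshift : ∀ c f → VanishesBelow c f → Xₚ ^ₚ c ⊛ (f ∘ (c ℕ.+_)) ≈ₚ f
Xₚ^⊛-unshift c f f≡0 = mk≈ₚ coeff
  where
  coeff : ∀ n → (Xₚ ^ₚ c ⊛ (f ∘ (c ℕ.+_))) n ≡ f n
  coeff n with split c n
  ... | below n<c = trans (Xₚ^⊛-vanishesBelow c (f ∘ (c ℕ.+_)) n n<c) (sym (f≡0 n n<c))
  ... | above t   = Xₚ^⊛-shift c (f ∘ (c ℕ.+_)) t

geomₚ-1≈Xₚ⊛geomₚ-0 : ∀ s → geomₚ 1 (suc s) ≈ₚ Xₚ ⊛ geomₚ 0 s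
geomₚ-1≈Xₚ⊛geomₚ-0 zero    = mk≈ₚ λ n → sym (trans (⊛≡conv Xₚ (geomₚ 0 0) n) (conv-vanishʳ Xₚ n (λ _ _ → refl)))
geomₚ-1≈Xₚ⊛geomₚ-0 (suc s) = begin
  geomₚ 1 (suc s) ⊕ Xₚ ⊛ Xₚ ^ₚ s        ≈⟨ ⊕-cong (geomₚ-1≈Xₚ⊛geomₚ-0 s) (≈ₚ-refl {Xₚ ⊛ Xₚ ^ₚ s}) ⟩
  Xₚ ⊛ geomₚ 0 s ⊕ Xₚ ⊛ Xₚ ^ₚ s         ≈⟨ ⊛-distribˡ-⊕ Xₚ (geomₚ 0 s) (Xₚ ^ₚ s) ⟨
  Xₚ ⊛ (geomₚ 0 s ⊕ Xₚ ^ₚ s)           ∎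
  where open ≈ₚ-Reasoning

geomₚ-0⊛-coeff : ∀ s f n → (geomₚ 0 s ⊛ f) n ≡ ∑ (s ⊓ suc n) (λ j → f (n ∸ j))
geomₚ-0⊛-coeff zero    f n =
  trans (at (⊛-comm (geomₚ 0 0) f) n) (trans (⊛≡conv f (geomₚ 0 0) n) (conv-vanishʳ f n (λ _ _ → refl)))
geomₚ-0⊛-coeff (suc s) f n =
  trans (at (⊛-distribʳ-⊕ (geomₚ 0 s) (Xₚ ^ₚ s) f) n)
        (trans (cong (_+ (Xₚ ^ₚ s ⊛ f) n) (geomₚ-0⊛-coeff s f n)) (new-term n (split s n)))
  where
  new-term : ∀ n → Split s n →
    ∑ (s ⊓ suc n) (λ j → f (n ∸ j)) + (Xₚ ^ₚ s ⊛ f) n ≡ ∑ (suc s ⊓ suc n) (λ j → f (n ∸ j))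
  new-term n (below n<s) = begin
    ∑ (s ⊓ suc n) g + (Xₚ ^ₚ s ⊛ f) n
      ≡⟨ cong₂ _+_ (cong (λ m → ∑ m g) (ℕ.m≥n⇒m⊓n≡n n<s)) (Xₚ^⊛-vanishesBelow s f n n<s) ⟩
    ∑ (suc n) g + + 0
      ≡⟨ ℤ.+-identityʳ _ ⟩
    ∑ (suc n) g
      ≡⟨ cong (λ m → ∑ m g) (ℕ.m≥n⇒m⊓n≡n (ℕ.m≤n⇒m≤1+n n<s)) ⟨
    ∑ (suc s ⊓ suc n) g ∎
    where
    open ≡-Reasoning
    g : ℕ → ℤ
    g j = f (n ∸ j)
  new-term _ (above t) = begin
    ∑ (s ⊓ suc (s ℕ.+ t)) g + (Xₚ ^ₚ s ⊛ f) (s ℕ.+ t)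
      ≡⟨ cong₂ _+_ (cong (λ m → ∑ m g) (ℕ.m≤n⇒m⊓n≡m s≤1+s+t)) (Xₚ^⊛-shift s f t) ⟩
    ∑ s g + f t
      ≡⟨ cong (_+_ (∑ s g) ∘ f) (ℕ.m+n∸m≡n s t) ⟨
    ∑ s g + g s
      ≡⟨ ∑-snoc s g ⟨
    ∑ (suc s) g
      ≡⟨ cong (λ m → ∑ m g) (ℕ.m≤n⇒m⊓n≡m (s≤s (ℕ.m≤m+n s t))) ⟨
    ∑ (suc s ⊓ suc (s ℕ.+ t)) g ∎
    where
    open ≡-Reasoning
    g : ℕ → ℤ
    g j = f (s ℕ.+ t ∸ j)
    s≤1+s+t : s ℕ.≤ suc (s ℕ.+ t)
    s≤1+s+t = ℕ.m≤n⇒m≤1+n (ℕ.m≤m+n s t)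

m<n⇒m⊖n<0 : ∀ {m n} → m ℕ.< n → m ⊖ n < + 0
m<n⇒m⊖n<0 m<n = subst (_< + 0) (sym (ℤ.⊖-< m<n)) (ℤ.neg-mono-< (+<+ (ℕ.m<n⇒0<n∸m m<n)))

binom-negˡ : ∀ s {z} k → z < + 0 → binom s z k ≡ 0
binom-negˡ s { -[1+ _ ]} k _         = refl
binom-negˡ s {+ _}      k (+<+ ())

binom-negʳ : ∀ s z {k} → k < + 0 → binom s z k ≡ 0
binom-negʳ s (+ _)    { -[1+ _ ]} _ = refl
binom-negʳ s -[1+ _ ] { -[1+ _ ]} _ = refl
binom-negʳ s _        {+ _}      (+<+ ())

sumℕ-map-vanish : ∀ (f : ℕ → ℕ) xs → (∀ x → f x ≡ 0) → sumℕ (map f xs) ≡ 0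
sumℕ-map-vanish f []       f≡0 = refl
sumℕ-map-vanish f (x ∷ xs) f≡0 = cong₂ ℕ._+_ (f≡0 x) (sumℕ-map-vanish f xs f≡0)

paths-vanish : ∀ s n k → n ℕ.< k → paths s n k ≡ 0
paths-vanish s zero    (suc k) _         = refl
paths-vanish s (suc n) (suc k) (s≤s n<k) = cong₂ ℕ._+_
  (paths-vanish s n (suc k) (ℕ.m≤n⇒m≤1+n n<k))
  (sumℕ-map-vanish _ (upTo (s ⊓ suc n))
    (λ j → paths-vanish s (n ∸ j) k (ℕ.≤-<-trans (ℕ.m∸n≤m n j) n<k)))

paths-suc-suc : ∀ s n k →
  + paths s (suc n) (suc k) - + paths s n (suc k) ≡ ∑ (s ⊓ suc n) (λ j → + paths s (n ∸ j) k)
paths-suc-suc s n k = begin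
  + (paths s n (suc k) ℕ.+ rest) - + paths s n (suc k)
    ≡⟨ cong (_- + paths s n (suc k)) (ℤ.pos-+ (paths s n (suc k)) rest) ⟩
  (+ paths s n (suc k) + + rest) - + paths s n (suc k)
    ≡⟨ [x+y]-x≡y (+ paths s n (suc k)) (+ rest) ⟩
  + rest
    ≡⟨ sumℕ-map-upTo (λ j → paths s (n ∸ j) k) (s ⊓ suc n) ⟩
  ∑ (s ⊓ suc n) (λ j → + paths s (n ∸ j) k) ∎
  where
  open ≡-Reasoning
  rest : ℕ
  rest = sumℕ (map (λ j → paths s (n ∸ j) k) (upTo (s ⊓ suc n)))

pathSeries : ℕ → ℕ → PS
pathSeries s k n = + paths s n k

[1-x] : PS
[1-x] = oneₚ ⊝ Xₚ

[1-x]⊛-zero : ∀ f → ([1-x] ⊛ f) 0 ≡ f 0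
[1-x]⊛-zero f = trans (at (⊛-distribʳ-⊝ oneₚ Xₚ f) 0)
  (trans (cong₂ _-_ (at (⊛-identityˡ f) 0) (Xₚ⊛-zero f)) (ℤ.+-identityʳ (f 0)))

[1-x]⊛-suc : ∀ f n → ([1-x] ⊛ f) (suc n) ≡ f (suc n) - f n
[1-x]⊛-suc f n = trans (at (⊛-distribʳ-⊝ oneₚ Xₚ f) (suc n))
  (cong₂ _-_ (at (⊛-identityˡ f) (suc n)) (Xₚ⊛-suc f n))

geomₚ-1⊛-zero : ∀ s f → (geomₚ 1 (suc s) ⊛ f) 0 ≡ + 0
geomₚ-1⊛-zero s f = trans (at (⊛-congˡ f (geomₚ-1≈Xₚ⊛geomₚ-0 s)) 0)
  (trans (at (⊛-assoc Xₚ (geomₚ 0 s) f) 0) (Xₚ⊛-zero (geomₚ 0 s ⊛ f)))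

geomₚ-1⊛-suc : ∀ s f n → (geomₚ 1 (suc s) ⊛ f) (suc n) ≡ ∑ (s ⊓ suc n) (λ j → f (n ∸ j))
geomₚ-1⊛-suc s f n = trans (at (⊛-congˡ f (geomₚ-1≈Xₚ⊛geomₚ-0 s)) (suc n))
  (trans (at (⊛-assoc Xₚ (geomₚ 0 s) f) (suc n))
  (trans (Xₚ⊛-suc (geomₚ 0 s ⊛ f) n) (geomₚ-0⊛-coeff s f n)))

module _ (s : ℕ) where

  private
    G : PS
    G = geomₚ 1 (suc s)
    P : ℕ → PS
    P = pathSeries s

  [1-x]⊛pathSeries-zero : [1-x] ⊛ P 0 ≈ₚ oneₚ
  [1-x]⊛pathSeries-zero = mk≈ₚ λ
    { zero    → [1-x]⊛-zero (P 0)
    ; (suc n) → trans ([1-x]⊛-suc (P 0) n) (ℤ.+-inverseʳ (+ paths s n 0))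
    }

  [1-x]⊛pathSeries-suc : ∀ k → [1-x] ⊛ P (suc k) ≈ₚ G ⊛ P k
  [1-x]⊛pathSeries-suc k = mk≈ₚ λ
    { zero    → trans ([1-x]⊛-zero (P (suc k))) (sym (geomₚ-1⊛-zero s (P k)))
    ; (suc n) → trans ([1-x]⊛-suc (P (suc k)) n)
                      (trans (paths-suc-suc s n k) (sym (geomₚ-1⊛-suc s (P k) n)))
    }

  [1-x]^⊛pathSeries : ∀ a m → [1-x] ^ₚ a ⊛ P (a ℕ.+ m) ≈ₚ G ^ₚ a ⊛ P m
  [1-x]^⊛pathSeries zero    m = ≈ₚ-refl {oneₚ ⊛ P m}
  [1-x]^⊛pathSeries (suc a) m = begin
    ([1-x] ⊛ [1-x] ^ₚ a) ⊛ P (suc a ℕ.+ m)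
      ≈⟨ xy∙z≈y∙xz [1-x] ([1-x] ^ₚ a) (P (suc a ℕ.+ m)) ⟩
    [1-x] ^ₚ a ⊛ ([1-x] ⊛ P (suc a ℕ.+ m))
      ≈⟨ ⊛-congʳ ([1-x] ^ₚ a) ([1-x]⊛pathSeries-suc (a ℕ.+ m)) ⟩
    [1-x] ^ₚ a ⊛ (G ⊛ P (a ℕ.+ m))
      ≈⟨ x∙yz≈y∙xz ([1-x] ^ₚ a) G (P (a ℕ.+ m)) ⟩
    G ⊛ ([1-x] ^ₚ a ⊛ P (a ℕ.+ m))
      ≈⟨ ⊛-congʳ G ([1-x]^⊛pathSeries a m) ⟩
    G ⊛ (G ^ₚ a ⊛ P m)
      ≈⟨ ⊛-assoc G (G ^ₚ a) (P m) ⟨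
    (G ⊛ G ^ₚ a) ⊛ P m ∎
    where open ≈ₚ-Reasoning

  [1-x]^suc⊛pathSeries : ∀ m → [1-x] ^ₚ suc m ⊛ P m ≈ₚ G ^ₚ m
  [1-x]^suc⊛pathSeries m = begin
    ([1-x] ⊛ [1-x] ^ₚ m) ⊛ P m
      ≈⟨ ⊛-assoc [1-x] ([1-x] ^ₚ m) (P m) ⟩
    [1-x] ⊛ ([1-x] ^ₚ m ⊛ P m)
      ≈⟨ ⊛-congʳ [1-x] [1-x]^m⊛P-m ⟩
    [1-x] ⊛ (G ^ₚ m ⊛ P 0)
      ≈⟨ x∙yz≈y∙xz [1-x] (G ^ₚ m) (P 0) ⟩
    G ^ₚ m ⊛ ([1-x] ⊛ P 0)
      ≈⟨ ⊛-congʳ (G ^ₚ m) [1-x]⊛pathSeries-zero ⟩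
    G ^ₚ m ⊛ oneₚ
      ≈⟨ ⊛-identityʳ (G ^ₚ m) ⟩
    G ^ₚ m ∎
    where
    open ≈ₚ-Reasoning
    [1-x]^m⊛P-m : [1-x] ^ₚ m ⊛ P m ≈ₚ G ^ₚ m ⊛ P 0
    [1-x]^m⊛P-m = subst (λ j → [1-x] ^ₚ m ⊛ P j ≈ₚ G ^ₚ m ⊛ P 0) (ℕ.+-identityʳ m) ([1-x]^⊛pathSeries m 0)

  binom-as-shiftedPaths : ∀ c j m → + binom s (+ m - + c) (+ j) ≡ (Xₚ ^ₚ c ⊛ P j) m
  binom-as-shiftedPaths c j m with split c m
  ... | below m<c = trans (cong +_ (binom-negˡ s (+ j) +m-+c<0)) (sym (Xₚ^⊛-vanishesBelow c (P j) m m<c))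
    where
    +m-+c<0 : + m - + c < + 0
    +m-+c<0 = subst (_< + 0) (sym (ℤ.[+m]-[+n]≡m⊖n m c)) (m<n⇒m⊖n<0 m<c)
  ... | above t   = trans (cong (λ z → + binom s z (+ j)) +[c+t]-+c≡+t) (sym (Xₚ^⊛-shift c (P j) t))
    where
    +[c+t]-+c≡+t : + (c ℕ.+ t) - + c ≡ + t
    +[c+t]-+c≡+t = trans (cong (_- + c) (ℤ.pos-+ c t)) ([x+y]-x≡y (+ c) (+ t))

  Xₚ^⊛pathSeries-vanishesBelow : ∀ c j → VanishesBelow (c ℕ.+ j) (Xₚ ^ₚ c ⊛ P j)
  Xₚ^⊛pathSeries-vanishesBelow c j = Xₚ^⊛-preserves-vanishesBelow c j (λ n n<j → cong +_ (paths-vanish s n j n<j))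

module Telescope (s α b e : ℕ) (r : ℤ) (r+α≡e : r + + α ≡ + e) where

  private
    H G : PS
    H = geomₚ 0 s
    G = geomₚ 1 (suc s)
    P : ℕ → PS
    P = pathSeries s

  denomTail : PS
  denomTail = Xₚ ^ₚ e ⊛ H ^ₚ α

  term : ℕ → PS
  term k n = + binom s (+ n - r * + k) (+ b + + α * + k)

  term-as-shiftedPaths : ∀ k n → term k n ≡ (Xₚ ^ₚ (e ℕ.* k) ⊛ P (b ℕ.+ α ℕ.* k)) (α ℕ.* k ℕ.+ n)
  term-as-shiftedPaths k n = trans (cong₂ (λ z w → + binom s z w) row column)
                                   (binom-as-shiftedPaths s (e ℕ.* k) (b ℕ.+ α ℕ.* k) (α ℕ.* k ℕ.+ n))
    where
    open ≡-Reasoning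
    shuffle : ∀ n r a k → n - r * k ≡ (a * k + n) - (r + a) * k
    shuffle = solve-∀
    row : + n - r * + k ≡ + (α ℕ.* k ℕ.+ n) - + (e ℕ.* k)
    row = begin
      + n - r * + k                         ≡⟨ shuffle (+ n) r (+ α) (+ k) ⟩
      (+ α * + k + + n) - (r + + α) * + k   ≡⟨ cong₂ (λ x y → (x + + n) - y * + k) (sym (ℤ.pos-* α k)) r+α≡e ⟩
      (+ (α ℕ.* k) + + n) - + e * + k       ≡⟨ cong₂ _-_ (sym (ℤ.pos-+ (α ℕ.* k) n)) (sym (ℤ.pos-* e k)) ⟩
      + (α ℕ.* k ℕ.+ n) - + (e ℕ.* k)       ∎
    column : + b + + α * + k ≡ + (b ℕ.+ α ℕ.* k)
    column = trans (cong (_+_ (+ b)) (sym (ℤ.pos-* α k))) (sym (ℤ.pos-+ b (α ℕ.* k)))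

  Xₚ^⊛term : ∀ k → Xₚ ^ₚ (α ℕ.* k) ⊛ term k ≈ₚ Xₚ ^ₚ (e ℕ.* k) ⊛ P (b ℕ.+ α ℕ.* k)
  Xₚ^⊛term k = ≈ₚ-trans (⊛-congʳ (Xₚ ^ₚ (α ℕ.* k)) (mk≈ₚ (term-as-shiftedPaths k)))
    (Xₚ^⊛-unshift (α ℕ.* k) _
      (vanishesBelow-mono αk≤ek+[b+αk] (Xₚ^⊛pathSeries-vanishesBelow s (e ℕ.* k) (b ℕ.+ α ℕ.* k))))
    where
    αk≤ek+[b+αk] : α ℕ.* k ℕ.≤ e ℕ.* k ℕ.+ (b ℕ.+ α ℕ.* k)
    αk≤ek+[b+αk] = ℕ.≤-trans (ℕ.m≤n+m (α ℕ.* k) b) (ℕ.m≤n+m _ (e ℕ.* k))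

  term-vanishesBelow : 1 ℕ.≤ e → ∀ k → VanishesBelow k (term k)
  term-vanishesBelow 1≤e k m m<k =
    trans (term-as-shiftedPaths k m)
          (Xₚ^⊛pathSeries-vanishesBelow s (e ℕ.* k) (b ℕ.+ α ℕ.* k) (α ℕ.* k ℕ.+ m) bound)
    where
    open ℕ.≤-Reasoning
    k≤ek : k ℕ.≤ e ℕ.* k
    k≤ek = ℕ.m≤n*m k e {{ℕ.>-nonZero 1≤e}}
    bound : α ℕ.* k ℕ.+ m ℕ.< e ℕ.* k ℕ.+ (b ℕ.+ α ℕ.* k)
    bound = begin-strict
      α ℕ.* k ℕ.+ m              <⟨ ℕ.+-monoʳ-< (α ℕ.* k) (ℕ.<-≤-trans m<k k≤ek) ⟩
      α ℕ.* k ℕ.+ e ℕ.* k        ≡⟨ ℕ.+-comm (α ℕ.* k) (e ℕ.* k) ⟩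
      e ℕ.* k ℕ.+ α ℕ.* k        ≤⟨ ℕ.+-monoʳ-≤ (e ℕ.* k) (ℕ.m≤n+m (α ℕ.* k) b) ⟩
      e ℕ.* k ℕ.+ (b ℕ.+ α ℕ.* k) ∎

  [1-x]^α⊛term-suc : ∀ k → [1-x] ^ₚ α ⊛ term (suc k) ≈ₚ denomTail ⊛ term k
  -- Compared after multiplication by x^{α(k+1)}, which turns both term k and term (suc k) into path series
  [1-x]^α⊛term-suc k = Xₚ^⊛-cancel (α ℕ.* suc k) (begin
    xᵅ⁽ᵏ⁺¹⁾ ⊛ ([1-x]ᵅ ⊛ term (suc k))
      ≈⟨ x∙yz≈y∙xz xᵅ⁽ᵏ⁺¹⁾ [1-x]ᵅ (term (suc k)) ⟩
    [1-x]ᵅ ⊛ (xᵅ⁽ᵏ⁺¹⁾ ⊛ term (suc k))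
      ≈⟨ ⊛-congʳ [1-x]ᵅ (Xₚ^⊛term (suc k)) ⟩
    [1-x]ᵅ ⊛ (xᵉ⁽ᵏ⁺¹⁾ ⊛ P (b ℕ.+ α ℕ.* suc k))
      ≈⟨ x∙yz≈y∙xz [1-x]ᵅ xᵉ⁽ᵏ⁺¹⁾ (P (b ℕ.+ α ℕ.* suc k)) ⟩
    xᵉ⁽ᵏ⁺¹⁾ ⊛ ([1-x]ᵅ ⊛ P (b ℕ.+ α ℕ.* suc k))
      ≈⟨ ⊛-congʳ xᵉ⁽ᵏ⁺¹⁾ (⊛-congʳ [1-x]ᵅ (≡⇒≈ₚ (cong P index))) ⟩
    xᵉ⁽ᵏ⁺¹⁾ ⊛ ([1-x]ᵅ ⊛ P (α ℕ.+ j))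
      ≈⟨ ⊛-congʳ xᵉ⁽ᵏ⁺¹⁾ ([1-x]^⊛pathSeries s α j) ⟩
    xᵉ⁽ᵏ⁺¹⁾ ⊛ (G ^ₚ α ⊛ P j)
      ≈⟨ ⊛-cong (^ₚ-*-suc Xₚ e k) (⊛-congˡ (P j) G^α≈xᵅ⊛Hᵅ) ⟩
    (xᵉ ⊛ xᵉᵏ) ⊛ ((xᵅ ⊛ Hᵅ) ⊛ P j)
      ≈⟨ solve 5 (λ p q u v w → (p · q) · ((u · v) · w) ⊜ u · ((p · v) · (q · w))) ≈ₚ-refl xᵉ xᵉᵏ xᵅ Hᵅ (P j) ⟩
    xᵅ ⊛ (denomTail ⊛ (xᵉᵏ ⊛ P j))
      ≈⟨ ⊛-congʳ xᵅ (⊛-congʳ denomTail (Xₚ^⊛term k)) ⟨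
    xᵅ ⊛ (denomTail ⊛ (xᵅᵏ ⊛ term k))
      ≈⟨ ⊛-congʳ xᵅ (x∙yz≈y∙xz denomTail xᵅᵏ (term k)) ⟩
    xᵅ ⊛ (xᵅᵏ ⊛ (denomTail ⊛ term k))
      ≈⟨ ⊛-assoc xᵅ xᵅᵏ (denomTail ⊛ term k) ⟨
    (xᵅ ⊛ xᵅᵏ) ⊛ (denomTail ⊛ term k)
      ≈⟨ ⊛-congˡ (denomTail ⊛ term k) (^ₚ-*-suc Xₚ α k) ⟨
    xᵅ⁽ᵏ⁺¹⁾ ⊛ (denomTail ⊛ term k) ∎)
    where
    open ≈ₚ-Reasoning
    open CommutativeMonoidSolver ⊛-commutativeMonoid using (solve; _⊜_) renaming (_⊕_ to _·_)
    xᵅ xᵉ xᵅᵏ xᵉᵏ xᵅ⁽ᵏ⁺¹⁾ xᵉ⁽ᵏ⁺¹⁾ Hᵅ [1-x]ᵅ : PS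
    xᵅ = Xₚ ^ₚ α
    xᵉ = Xₚ ^ₚ e
    xᵅᵏ = Xₚ ^ₚ (α ℕ.* k)
    xᵉᵏ = Xₚ ^ₚ (e ℕ.* k)
    xᵅ⁽ᵏ⁺¹⁾ = Xₚ ^ₚ (α ℕ.* suc k)
    xᵉ⁽ᵏ⁺¹⁾ = Xₚ ^ₚ (e ℕ.* suc k)
    Hᵅ = H ^ₚ α
    [1-x]ᵅ = [1-x] ^ₚ α
    j : ℕ
    j = b ℕ.+ α ℕ.* k
    index : b ℕ.+ α ℕ.* suc k ≡ α ℕ.+ j
    index = trans (cong (b ℕ.+_) (ℕ.*-suc α k)) (CSP.x∙yz≈y∙xz ℕ.+-commutativeSemigroup b α (α ℕ.* k))
    G^α≈xᵅ⊛Hᵅ : G ^ₚ α ≈ₚ xᵅ ⊛ Hᵅ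
    G^α≈xᵅ⊛Hᵅ = ≈ₚ-trans (^ₚ-cong (geomₚ-1≈Xₚ⊛geomₚ-0 s) α) (^ₚ-distrib-⊛ Xₚ H α)

  partialSum : ℕ → PS
  partialSum K n = ∑ (suc K) (λ k → term k n)

  denom⊛partialSum : ∀ K → denom α e s ⊛ partialSum K ≈ₚ [1-x] ^ₚ α ⊛ term 0 ⊝ denomTail ⊛ term K
  denom⊛partialSum zero    = ≈ₚ-trans (⊛-congʳ (denom α e s) (mk≈ₚ λ n → ℤ.+-identityʳ (term 0 n)))
                                      (⊛-distribʳ-⊝ ([1-x] ^ₚ α) denomTail (term 0))
  denom⊛partialSum (suc K) = begin
    D ⊛ partialSum (suc K)
      ≈⟨ ⊛-congʳ D (mk≈ₚ λ n → ∑-snoc (suc K) (λ k → term k n)) ⟩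
    D ⊛ (partialSum K ⊕ term (suc K))
      ≈⟨ ⊛-distribˡ-⊕ D (partialSum K) (term (suc K)) ⟩
    D ⊛ partialSum K ⊕ D ⊛ term (suc K)
      ≈⟨ ⊕-cong (denom⊛partialSum K) (⊛-distribʳ-⊝ ([1-x] ^ₚ α) denomTail (term (suc K))) ⟩
    ([1-x] ^ₚ α ⊛ term 0 ⊝ denomTail ⊛ term K) ⊕ ([1-x] ^ₚ α ⊛ term (suc K) ⊝ denomTail ⊛ term (suc K))
      ≈⟨ ⊕-cong (≈ₚ-refl {[1-x] ^ₚ α ⊛ term 0 ⊝ denomTail ⊛ term K})
                (⊝-cong ([1-x]^α⊛term-suc K) (≈ₚ-refl {denomTail ⊛ term (suc K)})) ⟩
    ([1-x] ^ₚ α ⊛ term 0 ⊝ denomTail ⊛ term K) ⊕ (denomTail ⊛ term K ⊝ denomTail ⊛ term (suc K))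
      ≈⟨ mk≈ₚ (λ n → telescope (([1-x] ^ₚ α ⊛ term 0) n) ((denomTail ⊛ term K) n)
                                 ((denomTail ⊛ term (suc K)) n)) ⟩
    [1-x] ^ₚ α ⊛ term 0 ⊝ denomTail ⊛ term (suc K) ∎
    where
    open ≈ₚ-Reasoning
    D : PS
    D = denom α e s
    telescope : ∀ a w v → (a - w) + (w - v) ≡ a - v
    telescope = solve-∀

  denomTail⊛term-vanishes : 1 ℕ.≤ e → ∀ K → (denomTail ⊛ term K) K ≡ + 0
  denomTail⊛term-vanishes 1≤e K = trans (at (⊛-assoc (Xₚ ^ₚ e) (H ^ₚ α) (term K)) K)
    (Xₚ^⊛-preserves-vanishesBelow e K (⊛-vanishesBelowʳ (H ^ₚ α) K (term-vanishesBelow 1≤e K)) K (ℕ.m<n+m K 1≤e))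

  partialSum-stable : 1 ℕ.≤ e → ∀ {m n} → m ℕ.≤ n → partialSum n m ≡ partialSum m m
  partialSum-stable 1≤e {m} {n} m≤n = begin
    ∑ (suc n) (λ k → term k m)
      ≡⟨ cong (λ l → ∑ (suc l) (λ k → term k m)) (ℕ.m+[n∸m]≡n m≤n) ⟨
    ∑ (suc m ℕ.+ (n ∸ m)) (λ k → term k m)
      ≡⟨ ∑-+ (suc m) (n ∸ m) (λ k → term k m) ⟩
    partialSum m m + ∑ (n ∸ m) (λ i → term (suc m ℕ.+ i) m)
      ≡⟨ cong (_+_ (partialSum m m)) (∑-zero (n ∸ m) beyond-m) ⟩
    partialSum m m + + 0
      ≡⟨ ℤ.+-identityʳ _ ⟩
    partialSum m m ∎
    where
    open ≡-Reasoning
    beyond-m : ∀ i → i ℕ.< n ∸ m → term (suc m ℕ.+ i) m ≡ + 0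
    beyond-m i _ = term-vanishesBelow 1≤e (suc m ℕ.+ i) m (s≤s (ℕ.m≤m+n m i))

  T≡partialSum : b ℕ.< α → ∀ m → T α (+ b) r s m ≡ partialSum m m
  T≡partialSum b<α m = begin
    sumℤ (map F (map (λ i → + i - + m) (upTo (suc (m ℕ.+ m)))))
      ≡⟨ cong sumℤ (map-∘ {g = F} {f = λ i → + i - + m} (upTo (suc (m ℕ.+ m)))) ⟨
    sumℤ (map (λ i → F (+ i - + m)) (upTo (suc (m ℕ.+ m))))
      ≡⟨ sumℤ-map-upTo (λ i → F (+ i - + m)) (suc (m ℕ.+ m)) ⟩
    ∑ (suc (m ℕ.+ m)) (λ i → F (+ i - + m))
      ≡⟨ cong (λ l → ∑ l (λ i → F (+ i - + m))) (ℕ.+-suc m m) ⟨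
    ∑ (m ℕ.+ suc m) (λ i → F (+ i - + m))
      ≡⟨ ∑-+ m (suc m) (λ i → F (+ i - + m)) ⟩
    ∑ m (λ i → F (+ i - + m)) + ∑ (suc m) (λ i → F (+ (m ℕ.+ i) - + m))
      ≡⟨ cong₂ _+_ (∑-zero m negative-k) (∑-cong (suc m) (λ i _ → cong F (+[m+i]-+m≡+i i))) ⟩
    + 0 + partialSum m m
      ≡⟨ ℤ.+-identityˡ _ ⟩
    partialSum m m ∎
    where
    open ≡-Reasoning
    F : ℤ → ℤ
    F k = + binom s (+ m - r * k) (+ b + + α * k)
    +[m+i]-+m≡+i : ∀ i → + (m ℕ.+ i) - + m ≡ + i
    +[m+i]-+m≡+i i = trans (cong (_- + m) (ℤ.pos-+ m i)) ([x+y]-x≡y (+ m) (+ i))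
    negative-k : ∀ i → i ℕ.< m → F (+ i - + m) ≡ + 0
    negative-k i i<m =
      cong +_ (binom-negʳ s (+ m - r * (+ i - + m)) (subst (_< + 0) (sym column) (m<n⇒m⊖n<0 b<α[m∸i])))
      where
      b<α[m∸i] : b ℕ.< α ℕ.* (m ∸ i)
      b<α[m∸i] = ℕ.<-≤-trans b<α (ℕ.m≤m*n α (m ∸ i) {{ℕ.>-nonZero (ℕ.m<n⇒0<n∸m i<m)}})
      column : + b + + α * (+ i - + m) ≡ b ⊖ (α ℕ.* (m ∸ i))
      column = begin
        + b + + α * (+ i - + m)
          ≡⟨ cong (λ k → + b + + α * k) (trans (ℤ.[+m]-[+n]≡m⊖n i m) (ℤ.⊖-< i<m)) ⟩
        + b + + α * - + (m ∸ i)
          ≡⟨ cong (_+_ (+ b)) (sym (ℤ.neg-distribʳ-* (+ α) (+ (m ∸ i)))) ⟩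
        + b - + α * + (m ∸ i)
          ≡⟨ cong (λ k → + b - k) (sym (ℤ.pos-* α (m ∸ i))) ⟩
        + b - + (α ℕ.* (m ∸ i))
          ≡⟨ ℤ.[+m]-[+n]≡m⊖n b (α ℕ.* (m ∸ i)) ⟩
        b ⊖ (α ℕ.* (m ∸ i)) ∎

  [1-x]^α⊛term-zero : b ℕ.< α → [1-x] ^ₚ α ⊛ term 0 ≈ₚ numer α b s
  [1-x]^α⊛term-zero b<α = begin
    [1-x] ^ₚ α ⊛ term 0
      ≈⟨ ⊛-cong (≡⇒≈ₚ (cong ([1-x] ^ₚ_) (sym α≡[α∸b∸1]+[1+b]))) term-zero≈P-b ⟩
    [1-x] ^ₚ ((α ∸ b ∸ 1) ℕ.+ suc b) ⊛ P b
      ≈⟨ ⊛-congˡ (P b) (^ₚ-distribˡ-+-⊛ [1-x] (α ∸ b ∸ 1) (suc b)) ⟩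
    ([1-x] ^ₚ (α ∸ b ∸ 1) ⊛ [1-x] ^ₚ suc b) ⊛ P b
      ≈⟨ ⊛-assoc ([1-x] ^ₚ (α ∸ b ∸ 1)) ([1-x] ^ₚ suc b) (P b) ⟩
    [1-x] ^ₚ (α ∸ b ∸ 1) ⊛ ([1-x] ^ₚ suc b ⊛ P b)
      ≈⟨ ⊛-congʳ ([1-x] ^ₚ (α ∸ b ∸ 1)) ([1-x]^suc⊛pathSeries s b) ⟩
    [1-x] ^ₚ (α ∸ b ∸ 1) ⊛ G ^ₚ b ∎
    where
    open ≈ₚ-Reasoning
    α≡[α∸b∸1]+[1+b] : (α ∸ b ∸ 1) ℕ.+ suc b ≡ α
    α≡[α∸b∸1]+[1+b] =
      trans (cong (ℕ._+ suc b) (trans (ℕ.∸-+-assoc α b 1) (cong (α ∸_) (ℕ.+-comm b 1)))) (ℕ.m∸n+n≡m b<α)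
    term-zero≈P-b : term 0 ≈ₚ P b
    term-zero≈P-b = mk≈ₚ λ n → cong₂ (λ z w → + binom s z w)
      (trans (cong (_-_ (+ n)) (ℤ.*-zeroʳ r)) (ℤ.+-identityʳ (+ n)))
      (trans (cong (_+_ (+ b)) (ℤ.*-zeroʳ (+ α))) (ℤ.+-identityʳ (+ b)))

mainTheorem8 : (s : ℕ) → s ≥ 1 → (r : ℤ) (α : ℕ) (β : ℤ) →
    + 0 ≤ β → β < + α → + 0 < r + + α →
    ∀ n → (denom α ∣ r + + α ∣ s ⊛ T α β r s) n ≡ numer α ∣ β ∣ s n
mainTheorem8 s _ r α (+ b) _ (+<+ b<α) 0<r+α n = begin
  (denom α e s ⊛ T α (+ b) r s) n
    ≡⟨ ⊛-coeff-congʳ (denom α e s) n T≡partialSum-n ⟩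
  (denom α e s ⊛ partialSum n) n
    ≡⟨ at (denom⊛partialSum n) n ⟩
  ([1-x] ^ₚ α ⊛ term 0) n - (denomTail ⊛ term n) n
    ≡⟨ cong (_-_ (([1-x] ^ₚ α ⊛ term 0) n)) (denomTail⊛term-vanishes 1≤e n) ⟩
  ([1-x] ^ₚ α ⊛ term 0) n - + 0
    ≡⟨ ℤ.+-identityʳ _ ⟩
  ([1-x] ^ₚ α ⊛ term 0) n
    ≡⟨ at ([1-x]^α⊛term-zero b<α) n ⟩
  numer α b s n ∎
  where
  open ≡-Reasoning
  e : ℕ
  e = ∣ r + + α ∣
  r+α≡e : r + + α ≡ + e
  r+α≡e = sym (ℤ.0≤i⇒+∣i∣≡i (ℤ.<⇒≤ 0<r+α))
  1≤e : 1 ℕ.≤ e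
  1≤e = ℤ.drop‿+<+ (subst (+ 0 <_) r+α≡e 0<r+α)
  open Telescope s α b e r r+α≡e
  T≡partialSum-n : ∀ i → i ℕ.≤ n → T α (+ b) r s i ≡ partialSum n i
  T≡partialSum-n i i≤n = trans (T≡partialSum b<α i) (sym (partialSum-stable 1≤e i≤n))
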